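{- Let $n\ge3$, let $H$ be a finite abelian group of order $2n^2+1$ and let $T\subseteq H$ satisfy $|T|=2n$, $T=T^{(-1)}$ and $T^2=2H-T^{(2)}+(2n-2)e$ in $\mathbb{Z}[H]$. Then $T\cap T^{(3)}=\emptyset$, where $T^{(3)}=\{t^3:t\in T\}$.
   Context: $H$ is written multiplicatively with identity $e$. In the group ring $\mathbb{Z}[H]$ a subset $A$ is identified with $\sum_{g\in A}g$ (so $H$ is the sum of all elements), and $A^{(t)}=\sum a_g g^t$ for $A=\sum a_g g$. -}

module Defs where

open import Level using (Level)
open import Data.Bool using (Bool; true; false; _∧_; if_then_else_)
open import Data.Nat using (ℕ; _+_; _*_)
open import Data.List using (List; length; filterᵇ; map)
open import Data.Nat.ListAction using (sum)
open import Data.List.Membership.Propositional using (_∈_)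
open import Data.List.Relation.Unary.Unique.Propositional using (Unique)
open import Relation.Binary.PropositionalEquality using (_≡_)
open import Relation.Binary.Definitions using (DecidableEquality)
open import Relation.Nullary.Decidable using (⌊_⌋)
open import Algebra.Core using (Op₁; Op₂)
open import Algebra.Structures using (IsAbelianGroup)

record FiniteAbelianGroup : Set₁ where
  field
    Carrier : Set
    _∙_     : Op₂ Carrier
    e       : Carrier
    _⁻¹     : Op₁ Carrier
    isAbelianGroup : IsAbelianGroup _≡_ _∙_ e _⁻¹
    _≟_     : DecidableEquality Carrier
    elems   : List Carrier
    elems-unique   : Unique elems
    elems-complete : ∀ x → x ∈ elems

  order : ℕ
  order = length elems

  card : (Carrier → Bool) → ℕ
  card A = length (filterᵇ A elems)

  -- coefficient of g in A^2 = A·A in Z[H]: #{(s,t) ∈ A×A : s t = g}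
  coeffSq : (Carrier → Bool) → Carrier → ℕ
  coeffSq A g = sum (map (λ s → length (filterᵇ (λ t → A s ∧ A t ∧ ⌊ (s ∙ t) ≟ g ⌋) elems)) elems)

  -- coefficient of g in A^(2) = Σ_{t∈A} t^2 in Z[H]: #{t ∈ A : t^2 = g}
  coeffPow2 : (Carrier → Bool) → Carrier → ℕ
  coeffPow2 A g = length (filterᵇ (λ t → A t ∧ ⌊ (t ∙ t) ≟ g ⌋) elems)

  -- coefficient of g in e (the identity of Z[H])
  δe : Carrier → ℕ
  δe g = if ⌊ g ≟ e ⌋ then 1 else 0

{-# OPTIONS --safe #-}
-- Suppose t = s³ with s, t ∈ T and compare coefficients at g = s² in
-- T² + T⁽²⁾ = 2H + (2n − 2)e, where the right side has coefficient 2n at e and 2 elsewhere.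
-- If s² = e, the coefficient of e in T² is at least |T| = 2n (the pairs (a, a⁻¹), as T = T⁽⁻¹⁾)
-- and s contributes to T⁽²⁾ at e, giving at least 2n + 1.  If s² ≠ e, then s·s = s² = t·s⁻¹
-- are two representations of s² in T² with distinct first factors (s = t would force s² = e),
-- and s contributes to T⁽²⁾ at s², giving at least 3.
module Submission where

open import Defs
open import Data.Bool using (Bool; true; false; _∧_; if_then_else_)
open import Data.Nat using (ℕ; _≤_; _+_; _*_; _∸_; z≤n; s≤s)
open import Data.Nat.Properties
  using (≤-trans; n≤1+n; m≤m+n; m≤n+m; +-monoʳ-≤; +-mono-≤; +-comm; m<m+n; *-identityʳ; *-zeroʳ;
         *-monoʳ-≤; m+[n∸m]≡n; <-irrefl; module ≤-Reasoning)
open import Data.Integer using (+_; _-_)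
import Data.Integer.Properties as ℤ
open import Data.Integer.Solver using (module +-*-Solver)
open import Data.List using (List; []; _∷_; length; filterᵇ; map)
open import Data.Nat.ListAction using (sum)
open import Data.List.Membership.Propositional using (_∈_)
open import Data.List.Relation.Unary.Any using (here; there)
open import Function using (_∘_)
open import Relation.Nullary using (Dec; ¬_; contradiction)
open import Relation.Nullary.Decidable using (⌊_⌋; isYes≗does; dec-true; dec-false)
open import Relation.Binary.PropositionalEquality
  using (_≡_; _≢_; refl; sym; trans; cong; subst; subst₂; module ≡-Reasoning)
open import Algebra.Bundles using (Group)
open import Algebra.Structures using (IsAbelianGroup)
import Algebra.Properties.Group as GroupProperties

⌊⌋-true : ∀ {A : Set} (a? : Dec A) → A → ⌊ a? ⌋ ≡ true
⌊⌋-true a? a = trans (isYes≗does a?) (dec-true a? a)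

⌊⌋-false : ∀ {A : Set} (a? : Dec A) → ¬ A → ⌊ a? ⌋ ≡ false
⌊⌋-false a? ¬a = trans (isYes≗does a?) (dec-false a? ¬a)

module _ {A : Set} where

  1≤length-filterᵇ : (P : A → Bool) {xs : List A} {x : A} → x ∈ xs → P x ≡ true →
                     1 ≤ length (filterᵇ P xs)
  1≤length-filterᵇ P (here refl) Px rewrite Px = s≤s z≤n
  1≤length-filterᵇ P {y ∷ _} (there x∈ys) Px with P y
  ... | true  = ≤-trans (1≤length-filterᵇ P x∈ys Px) (n≤1+n _)
  ... | false = 1≤length-filterᵇ P x∈ys Px

  ∈⇒≤sum-map : (f : A → ℕ) {xs : List A} {x : A} → x ∈ xs → f x ≤ sum (map f xs)
  ∈⇒≤sum-map f (here refl)  = m≤m+n (f _) _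
  ∈⇒≤sum-map f {y ∷ _} (there x∈ys) = ≤-trans (∈⇒≤sum-map f x∈ys) (m≤n+m _ (f y))

  ∈-distinct⇒+≤sum-map : (f : A → ℕ) {xs : List A} {x y : A} → x ≢ y → x ∈ xs → y ∈ xs →
                         f x + f y ≤ sum (map f xs)
  ∈-distinct⇒+≤sum-map f x≢y (here refl) (here refl)  = contradiction refl x≢y
  ∈-distinct⇒+≤sum-map f x≢y (here refl) (there y∈zs) = +-monoʳ-≤ (f _) (∈⇒≤sum-map f y∈zs)
  ∈-distinct⇒+≤sum-map f {y ∷ zs} {x} x≢y (there x∈zs) (here refl) =
    subst (_≤ f y + sum (map f zs)) (+-comm (f y) (f x)) (+-monoʳ-≤ (f y) (∈⇒≤sum-map f x∈zs))
  ∈-distinct⇒+≤sum-map f {z ∷ _} x≢y (there x∈zs) (there y∈zs) =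
    ≤-trans (∈-distinct⇒+≤sum-map f x≢y x∈zs y∈zs) (m≤n+m _ (f z))

  length-filterᵇ≤sum-map : (f : A → ℕ) (P : A → Bool) (xs : List A) →
                           (∀ x → P x ≡ true → 1 ≤ f x) → length (filterᵇ P xs) ≤ sum (map f xs)
  length-filterᵇ≤sum-map f P []       _ = z≤n
  length-filterᵇ≤sum-map f P (y ∷ ys) P⇒1≤f with P y in Py
  ... | true  = +-mono-≤ (P⇒1≤f y Py) (length-filterᵇ≤sum-map f P ys P⇒1≤f)
  ... | false = ≤-trans (length-filterᵇ≤sum-map f P ys P⇒1≤f) (m≤n+m _ (f y))

c≡a-p+k⇒c+p≡a+k : ∀ c a p k → + c ≡ (+ a - + p) Data.Integer.+ + k → c + p ≡ a + k
c≡a-p+k⇒c+p≡a+k c a p k eq = ℤ.+-injective (begin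
  + (c + p)                                           ≡⟨ ℤ.pos-+ c p ⟩
  + c ℤ+ + p                                          ≡⟨ cong (_ℤ+ + p) eq ⟩
  ((+ a - + p) ℤ+ + k) ℤ+ + p                         ≡⟨ solve 3 (λ a p k → ((a :- p) :+ k) :+ p := a :+ k)
                                                               refl (+ a) (+ p) (+ k) ⟩
  + a ℤ+ + k                                          ≡⟨ ℤ.pos-+ a k ⟨
  + (a + k)                                           ∎)
  where
  open ≡-Reasoning
  open +-*-Solver
  open Data.Integer renaming (_+_ to _ℤ+_) using ()

module Coefficients (H : FiniteAbelianGroup) where

  open FiniteAbelianGroup H
  open IsAbelianGroup isAbelianGroup using (isGroup; inverseʳ)

  group : Group _ _
  group = record { isGroup = isGroup }

  open GroupProperties group using (identityˡ-unique; x≈z//y)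

  factorCount : (Carrier → Bool) → Carrier → Carrier → ℕ
  factorCount A g a = length (filterᵇ (λ b → A a ∧ A b ∧ ⌊ (a ∙ b) ≟ g ⌋) elems)

  module _ {A : Carrier → Bool} where

    1≤factorCount : ∀ {g a b} → A a ≡ true → A b ≡ true → a ∙ b ≡ g → 1 ≤ factorCount A g a
    1≤factorCount {g} {a} {b} Aa Ab ab≡g =
      1≤length-filterᵇ _ (elems-complete b) (subst₂ (λ x y → x ∧ y ∧ ⌊ (a ∙ b) ≟ g ⌋ ≡ true)
                                                   (sym Aa) (sym Ab) (⌊⌋-true ((a ∙ b) ≟ g) ab≡g))

    1≤coeffPow2 : ∀ {s} → A s ≡ true → 1 ≤ coeffPow2 A (s ∙ s)
    1≤coeffPow2 {s} As =
      1≤length-filterᵇ _ (elems-complete s) (subst (λ x → x ∧ ⌊ (s ∙ s) ≟ (s ∙ s) ⌋ ≡ true)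
                                                   (sym As) (⌊⌋-true ((s ∙ s) ≟ (s ∙ s)) refl))

    card≤coeffSq-e : (∀ g → A (g ⁻¹) ≡ A g) → card A ≤ coeffSq A e
    card≤coeffSq-e A-symmetric = length-filterᵇ≤sum-map (factorCount A e) A elems
      (λ a Aa → 1≤factorCount Aa (trans (A-symmetric a) Aa) (inverseʳ a))

    2≤coeffSq : ∀ {g a b a′ b′} → a ≢ a′ →
                A a ≡ true → A b ≡ true → a ∙ b ≡ g →
                A a′ ≡ true → A b′ ≡ true → a′ ∙ b′ ≡ g → 2 ≤ coeffSq A g
    2≤coeffSq a≢a′ Aa Ab ab≡g Aa′ Ab′ a′b′≡g =
      ≤-trans (+-mono-≤ (1≤factorCount Aa Ab ab≡g) (1≤factorCount Aa′ Ab′ a′b′≡g))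
              (∈-distinct⇒+≤sum-map _ a≢a′ (elems-complete _) (elems-complete _))

  δe-e : δe e ≡ 1
  δe-e = cong (if_then 1 else 0) (⌊⌋-true (e ≟ e) refl)

  δe-≢e : ∀ {g} → g ≢ e → δe g ≡ 0
  δe-≢e {g} g≢e = cong (if_then 1 else 0) (⌊⌋-false (g ≟ e) g≢e)

  cube-fixed⇒square≡e : ∀ {s} → (s ∙ s) ∙ s ≡ s → s ∙ s ≡ e
  cube-fixed⇒square≡e = identityˡ-unique _ _

  cube-quotient : ∀ {s t} → (s ∙ s) ∙ s ≡ t → t ∙ (s ⁻¹) ≡ s ∙ s
  cube-quotient = sym ∘ x≈z//y _ _ _

lemma4 : (n : ℕ) → 3 ≤ n → (H : FiniteAbelianGroup) →
         let open FiniteAbelianGroup H in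
         order ≡ 2 * n * n + 1 →
         (T : Carrier → Bool) →
         card T ≡ 2 * n →
         (∀ g → T (g ⁻¹) ≡ T g) →
         (∀ g → + coeffSq T g ≡ (+ 2 - + coeffPow2 T g) Data.Integer.+ + ((2 * n ∸ 2) * δe g)) →
         ∀ t s → T t ≡ true → T s ≡ true → t ≢ (s ∙ s) ∙ s
lemma4 n 3≤n H _ T |T|≡2n T-symmetric T²-identity t s Tt Ts t≡s³ = <-irrefl refl (begin-strict
  2                                       ≤⟨ 2≤coeffSq s≢t Ts Ts refl Tt Ts⁻¹ (cube-quotient (sym t≡s³)) ⟩
  coeffSq T (s ∙ s)                       <⟨ m<m+n _ (1≤coeffPow2 Ts) ⟩
  coeffSq T (s ∙ s) + coeffPow2 T (s ∙ s) ≡⟨ coeffs-≢e s²≢e ⟩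
  2                                       ∎)
  where
  open FiniteAbelianGroup H
  open Coefficients H
  open ≤-Reasoning

  coeffs : ∀ g → coeffSq T g + coeffPow2 T g ≡ 2 + (2 * n ∸ 2) * δe g
  coeffs g = c≡a-p+k⇒c+p≡a+k _ _ _ _ (T²-identity g)

  coeffs-e : coeffSq T e + coeffPow2 T e ≡ 2 * n
  coeffs-e = begin-equality
    coeffSq T e + coeffPow2 T e ≡⟨ coeffs e ⟩
    2 + (2 * n ∸ 2) * δe e      ≡⟨ cong (λ d → 2 + (2 * n ∸ 2) * d) δe-e ⟩
    2 + (2 * n ∸ 2) * 1         ≡⟨ cong (λ m → 2 + m) (*-identityʳ (2 * n ∸ 2)) ⟩
    2 + (2 * n ∸ 2)             ≡⟨ m+[n∸m]≡n (*-monoʳ-≤ 2 (≤-trans (s≤s z≤n) 3≤n)) ⟩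
    2 * n                       ∎

  coeffs-≢e : ∀ {g} → g ≢ e → coeffSq T g + coeffPow2 T g ≡ 2
  coeffs-≢e {g} g≢e = begin-equality
    coeffSq T g + coeffPow2 T g ≡⟨ coeffs g ⟩
    2 + (2 * n ∸ 2) * δe g      ≡⟨ cong (λ d → 2 + (2 * n ∸ 2) * d) (δe-≢e g≢e) ⟩
    2 + (2 * n ∸ 2) * 0         ≡⟨ cong (λ m → 2 + m) (*-zeroʳ (2 * n ∸ 2)) ⟩
    2                           ∎

  Ts⁻¹ : T (s ⁻¹) ≡ true
  Ts⁻¹ = trans (T-symmetric s) Ts

  s²≢e : s ∙ s ≢ e
  s²≢e s²≡e = <-irrefl refl (begin-strict
    2 * n                       ≡⟨ |T|≡2n ⟨
    card T                      ≤⟨ card≤coeffSq-e T-symmetric ⟩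
    coeffSq T e                 <⟨ m<m+n _ (subst (λ g → 1 ≤ coeffPow2 T g) s²≡e (1≤coeffPow2 Ts)) ⟩
    coeffSq T e + coeffPow2 T e ≡⟨ coeffs-e ⟩
    2 * n                       ∎)

  s≢t : s ≢ t
  s≢t s≡t = s²≢e (cube-fixed⇒square≡e (trans (sym t≡s³) (sym s≡t)))
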